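{- Let $\mathcal{R}=[r_{i,j}]$, $i\ge 0$, $j\in\mathbb{Z}$, be the Pascal rhombus, defined by $r_{0,0}=r_{1,-1}=r_{1,0}=r_{1,1}=1$, $r_{0,j}=0$ for $j\neq 0$, $r_{1,j}=0$ for $j\notin\{ -1,0,1\}$, and $$r_{i,j}=r_{i-1,j-1}+r_{i-1,j}+r_{i-1,j+1}+r_{i-2,j},\quad i\ge 2,\ j\in\mathbb{Z}.$$ Then for all $n\ge 0$ and $j\in\mathbb{Z}$, $r_{n,j}=g^{(2)}_{n,j}$, the number of 2-generalized grand Motzkin paths of length $n$ and height $j$.
   Context: A 2-generalized grand Motzkin path of length $n$ is a lattice path in $\mathbb{Z}\times\mathbb{Z}$ starting at $(0,0)$ and ending at a point with $x$-coordinate $n$, using steps $U=(1,1)$, $D=(1,-1)$, $H=(1,0)$ and $H_2=(2,0)$ (no restriction relative to the $x$-axis). Its height is the $y$-coordinate of its endpoint. -}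

module Defs where

open import Data.Nat using (ℕ; zero; suc; _+_)
open import Data.Integer using (ℤ; 0ℤ; 1ℤ; -1ℤ) renaming (_+_ to _+ℤ_; _-_ to _-ℤ_; suc to sucℤ; pred to predℤ)
open import Data.List using (List; []; _∷_)
open import Data.Product using (Σ; _×_)
open import Data.Fin using (Fin)
open import Function.Bundles using (_↔_)
open import Relation.Binary.PropositionalEquality using (_≡_)
open import Relation.Nullary using (does)
open import Data.Integer using (_≟_)
open import Data.Bool using (if_then_else_)

rhombus : ℕ → ℤ → ℕ
rhombus zero j = if does (j ≟ 0ℤ) then 1 else 0
rhombus (suc zero) j =
  if does (j ≟ -1ℤ) then 1 else
  if does (j ≟ 0ℤ) then 1 else
  if does (j ≟ 1ℤ) then 1 else 0
rhombus (suc (suc i)) j =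
  rhombus (suc i) (predℤ j) + rhombus (suc i) j + rhombus (suc i) (sucℤ j) + rhombus i j

data Step : Set where
  U D H H₂ : Step

stepLen : Step → ℕ
stepLen U = 1
stepLen D = 1
stepLen H = 1
stepLen H₂ = 2

stepRise : Step → ℤ
stepRise U = 1ℤ
stepRise D = -1ℤ
stepRise H = 0ℤ
stepRise H₂ = 0ℤ

-- a path from (0,0) is a list of steps; its length is the x-coordinate of the endpoint
pathLength : List Step → ℕ
pathLength [] = 0
pathLength (s ∷ p) = stepLen s + pathLength p

pathHeight : List Step → ℤ
pathHeight [] = 0ℤ
pathHeight (s ∷ p) = stepRise s +ℤ pathHeight p

GMotzkin2 : ℕ → ℤ → Set
GMotzkin2 n j = Σ (List Step) (λ p → pathLength p ≡ n × pathHeight p ≡ j)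

-- "g n j = m" means: there are exactly m such paths (a bijection with Fin m)
HasCount : Set → ℕ → Set
HasCount A m = Fin m ↔ A

module Submission where

-- Idea: classify a path of length n + 1 by its first step.  Removing a first
-- U, H or D leaves a path of length n and height j - 1, j or j + 1; removing
-- a first H₂ leaves a path of length n - 1 and height j (impossible if
-- n = 0).  This gives an explicit bijection (firstStep-↔) between paths of
-- length n + 1 and a disjoint sum of four smaller path families, mirroring
-- the rhombus recurrence term by term.  Counts add under disjoint sums
-- (HasCount-⊎), so the theorem follows by induction on n: length 0 is
-- checked directly (only the empty path), length 1 uses the recurrence with
-- an empty fourth summand, and length ≥ 2 uses the rhombus recurrence.

open import Defs
open import Data.Nat using (ℕ; zero; suc; _+_)
open import Data.Integer using (ℤ; +_; -[1+_]; 0ℤ)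
  renaming (_+_ to _+ℤ_; suc to sucℤ; pred to predℤ; _≟_ to _≟ℤ_)
import Data.Integer.Properties as ℤP
import Data.Nat.Properties as ℕP
open import Data.List using (List; []; _∷_)
open import Data.Product using (_×_; _,_)
open import Data.Sum using (_⊎_; inj₁; inj₂)
open import Data.Empty using (⊥; ⊥-elim)
open import Data.Fin using (Fin)
import Data.Fin as Fin
open import Data.Fin.Properties using (+↔⊎)
open import Function.Bundles using (_↔_; mk↔ₛ′)
open import Function.Properties.Inverse using (↔-trans; ↔-sym)
open import Data.Sum.Function.Propositional using (_⊎-↔_)
open import Relation.Binary.PropositionalEquality
  using (_≡_; refl; sym; trans; cong)
open import Relation.Nullary using (yes; no)
import Axiom.UniquenessOfIdentityProofs as UIP

HasCount-⊥ : HasCount ⊥ 0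
HasCount-⊥ = mk↔ₛ′ (λ ()) (λ ()) (λ ()) (λ ())

HasCount-⊎ : ∀ {A B : Set} {a b : ℕ} →
             HasCount A a → HasCount B b → HasCount (A ⊎ B) (a + b)
HasCount-⊎ countA countB = ↔-trans +↔⊎ (countA ⊎-↔ countB)

HasCount-↔ : ∀ {A B : Set} {m : ℕ} → A ↔ B → HasCount A m → HasCount B m
HasCount-↔ A↔B countA = ↔-trans countA A↔B

-- A path determines its element of GMotzkin2 n j: the length and height
-- constraints are equalities in ℕ and ℤ, which have unique proofs.

path-≡ : ∀ {n j} {p : List Step} {c c′ : pathLength p ≡ n × pathHeight p ≡ j} →
         _≡_ {A = GMotzkin2 n j} (p , c) (p , c′)
path-≡ {c = l , h} {c′ = l′ , h′}
  rewrite ℕP.≡-irrelevant l l′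
        | UIP.Decidable⇒UIP.≡-irrelevant _≟ℤ_ h h′ = refl

GMotzkin2-pred : ℕ → ℤ → Set
GMotzkin2-pred zero    j = ⊥
GMotzkin2-pred (suc n) j = GMotzkin2 n j

-- The four ways a path of length n + 1 and height j can start: with U, H, D
-- or H₂, bracketed to match the rhombus recurrence.

FirstStepCases : ℕ → ℤ → Set
FirstStepCases n j =
  ((GMotzkin2 n (predℤ j) ⊎ GMotzkin2 n j) ⊎ GMotzkin2 n (sucℤ j))
  ⊎ GMotzkin2-pred n j

-- Heights shift by the rise of the step: a first U (rise 1ℤ + _ = sucℤ)
-- leaves height pred j, a first D (rise -1ℤ + _ = predℤ) leaves height suc j.

module FirstStep where

  suc-injective : ∀ {a b : ℕ} → suc a ≡ suc b → a ≡ b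
  suc-injective refl = refl

  split : ∀ n j → GMotzkin2 (suc n) j → FirstStepCases n j
  split n j (U ∷ p , l , h) =
    inj₁ (inj₁ (inj₁ (p , suc-injective l , trans (sym (ℤP.pred-suc _)) (cong predℤ h))))
  split n j (H ∷ p , l , h) =
    inj₁ (inj₁ (inj₂ (p , suc-injective l , trans (sym (ℤP.+-identityˡ _)) h)))
  split n j (D ∷ p , l , h) =
    inj₁ (inj₂ (p , suc-injective l , trans (sym (ℤP.suc-pred _)) (cong sucℤ h)))
  split zero    j (H₂ ∷ p , () , h)
  split (suc n) j (H₂ ∷ p , l , h) =
    inj₂ (p , suc-injective (suc-injective l) , trans (sym (ℤP.+-identityˡ _)) h)

  prepend : ∀ n j → FirstStepCases n j → GMotzkin2 (suc n) j
  prepend n j (inj₁ (inj₁ (inj₁ (p , l , h)))) =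
    U ∷ p , cong suc l , trans (cong sucℤ h) (ℤP.suc-pred j)
  prepend n j (inj₁ (inj₁ (inj₂ (p , l , h)))) =
    H ∷ p , cong suc l , trans (ℤP.+-identityˡ _) h
  prepend n j (inj₁ (inj₂ (p , l , h))) =
    D ∷ p , cong suc l , trans (cong predℤ h) (ℤP.pred-suc j)
  prepend (suc n) j (inj₂ (p , l , h)) =
    H₂ ∷ p , cong (λ m → suc (suc m)) l , trans (ℤP.+-identityˡ _) h

  split-prepend : ∀ n j x → split n j (prepend n j x) ≡ x
  split-prepend n j (inj₁ (inj₁ (inj₁ _))) = cong (λ z → inj₁ (inj₁ (inj₁ z))) path-≡
  split-prepend n j (inj₁ (inj₁ (inj₂ _))) = cong (λ z → inj₁ (inj₁ (inj₂ z))) path-≡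
  split-prepend n j (inj₁ (inj₂ _))        = cong (λ z → inj₁ (inj₂ z)) path-≡
  split-prepend (suc n) j (inj₂ _)         = cong inj₂ path-≡

  prepend-split : ∀ n j x → prepend n j (split n j x) ≡ x
  prepend-split n j (U ∷ _ , _)          = path-≡
  prepend-split n j (H ∷ _ , _)          = path-≡
  prepend-split n j (D ∷ _ , _)          = path-≡
  prepend-split zero    j (H₂ ∷ _ , () , _)
  prepend-split (suc n) j (H₂ ∷ _ , _)   = path-≡

firstStep-↔ : ∀ n j → FirstStepCases n j ↔ GMotzkin2 (suc n) j
firstStep-↔ n j = mk↔ₛ′ (prepend n j) (split n j) (prepend-split n j) (split-prepend n j)
  where open FirstStep

length-0⇒height-0 : ∀ {j} → GMotzkin2 0 j → 0ℤ ≡ j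
length-0⇒height-0 ([] , _ , h)      = h
length-0⇒height-0 (U  ∷ _ , () , _)
length-0⇒height-0 (D  ∷ _ , () , _)
length-0⇒height-0 (H  ∷ _ , () , _)
length-0⇒height-0 (H₂ ∷ _ , () , _)

count-length-0 : ∀ j → HasCount (GMotzkin2 0 j) (rhombus 0 j)
count-length-0 j with j ≟ℤ 0ℤ
... | yes refl = mk↔ₛ′ (λ _ → [] , refl , refl) (λ _ → Fin.zero) only-empty only-zero
  where
  only-empty : ∀ (x : GMotzkin2 0 0ℤ) → ([] , refl , refl) ≡ x
  only-empty ([] , refl , refl) = refl
  only-empty (U  ∷ _ , () , _)
  only-empty (D  ∷ _ , () , _)
  only-empty (H  ∷ _ , () , _)
  only-empty (H₂ ∷ _ , () , _)
  only-zero : ∀ (i : Fin 1) → Fin.zero ≡ i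
  only-zero Fin.zero = refl
... | no j≢0 = mk↔ₛ′ (λ ()) (λ x → impossible x) (λ x → impossible x) (λ ())
  where
  impossible : ∀ {B : Set} → GMotzkin2 0 j → B
  impossible x = ⊥-elim (j≢0 (sym (length-0⇒height-0 x)))

rhombus-row-1 : ∀ j → rhombus 1 j ≡ rhombus 0 (predℤ j) + rhombus 0 j + rhombus 0 (sucℤ j) + 0
rhombus-row-1 (+ zero)          = refl
rhombus-row-1 (+ suc zero)      = refl
rhombus-row-1 (+ suc (suc _))   = refl
rhombus-row-1 -[1+ zero ]       = refl
rhombus-row-1 -[1+ suc _ ]      = refl

theorem2p3 : (n : ℕ) → (j : ℤ) → HasCount (GMotzkin2 n j) (rhombus n j)
theorem2p3 zero j = count-length-0 j
theorem2p3 (suc zero) j rewrite rhombus-row-1 j =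
  HasCount-↔ (firstStep-↔ 0 j)
    (HasCount-⊎ (HasCount-⊎ (HasCount-⊎ (count-length-0 (predℤ j)) (count-length-0 j))
                            (count-length-0 (sucℤ j)))
                HasCount-⊥)
theorem2p3 (suc (suc i)) j =
  HasCount-↔ (firstStep-↔ (suc i) j)
    (HasCount-⊎ (HasCount-⊎ (HasCount-⊎ (theorem2p3 (suc i) (predℤ j)) (theorem2p3 (suc i) j))
                            (theorem2p3 (suc i) (sucℤ j)))
                (theorem2p3 i j))
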